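{- Let $\mathcal{G}=\langle G_1,\dots,G_L\rangle$ be a non-strict temporal graph on vertex set $V$ in which every layer consists of exactly two components and no two consecutive layers have the same partition. Suppose the transition from step $i$ to step $i+1$ is restricted, and let $B$ be its shrinking component. Then there is a component $C$ of $G_{i+1}$ with $B\cap C\neq\emptyset$ and $B\cup C=V$; that is, a non-strict temporal walk that visits $B$ in step $i$ can visit all vertices of $V$ in steps $i$ and $i+1$.
   Context: A non-strict temporal graph is a sequence of partitions $G_t$ of $V$ (components); a non-strict temporal walk visits one component per consecutive timestep, consecutive components intersecting, and visits the union of these components. With $G_i=\{A_i,B_i\}$, $G_{i+1}=\{A_{i+1},B_{i+1}\}$, the transition from step $i$ to $i+1$ is restricted if exactly one of $A_i\cap A_{i+1}$, $A_i\cap B_{i+1}$, $B_i\cap A_{i+1}$, $B_i\cap B_{i+1}$ is empty. In a restricted transition, the shrinking component is the component of $G_i$ that strictly contains a component of $G_{i+1}$ (equivalently, the component of $G_i$ that intersects both components of $G_{i+1}$); the other component of $G_i$ is strictly contained in a component of $G_{i+1}$ (the growing component). -}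

module Defs where

open import Data.Nat using (ℕ; suc)
import Data.Fin as Fin
open Fin using (Fin; toℕ)
open import Data.Fin.Subset using (Subset; _∩_; _∪_; ⊤; Nonempty; Empty; _⊂_)
open import Data.Product using (_×_; ∃; Σ)
open import Data.Sum using (_⊎_)
open import Relation.Binary.PropositionalEquality using (_≡_; _≢_)
open import Relation.Nullary using (¬_)

record TwoPartition (n : ℕ) : Set where
  field
    A B      : Subset n
    A-ne     : Nonempty A
    B-ne     : Nonempty B
    disjoint : Empty (A ∩ B)
    covers   : A ∪ B ≡ ⊤
open TwoPartition public

IsComponent : ∀ {n} → TwoPartition n → Subset n → Set
IsComponent P C = C ≡ A P ⊎ C ≡ B P

SamePartition : ∀ {n} → TwoPartition n → TwoPartition n → Set
SamePartition P Q = (A P ≡ A Q × B P ≡ B Q) ⊎ (A P ≡ B Q × B P ≡ A Q)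

TemporalGraph : ℕ → ℕ → Set
TemporalGraph n L = Fin L → TwoPartition n

intersections : ∀ {n} → TwoPartition n → TwoPartition n → Fin 4 → Subset n
intersections P Q Fin.zero = A P ∩ A Q
intersections P Q (Fin.suc Fin.zero) = A P ∩ B Q
intersections P Q (Fin.suc (Fin.suc Fin.zero)) = B P ∩ A Q
intersections P Q (Fin.suc (Fin.suc (Fin.suc Fin.zero))) = B P ∩ B Q

Restricted : ∀ {n} → TwoPartition n → TwoPartition n → Set
Restricted P Q = ∃ λ (k : Fin 4) →
  Empty (intersections P Q k) × (∀ j → j ≢ k → Nonempty (intersections P Q j))

Shrinking : ∀ {n} → TwoPartition n → TwoPartition n → Subset n → Set
Shrinking P Q S = IsComponent P S × ∃ λ C → IsComponent Q C × C ⊂ S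

-- If a component C of G_{i+1} lies strictly inside B, the other component D of G_{i+1}
-- covers everything C does not; hence B ∪ D = V, and a vertex of B outside C lies in B ∩ D.
module Submission where

open import Defs
open import Data.Nat using (suc)
open import Data.Fin using (Fin; toℕ)
open import Data.Fin.Subset using (Subset; _∩_; _∪_; ⊤; Nonempty; _∈_; _⊂_)
open import Data.Fin.Subset.Properties
  using (∈⊤; ⊆⊤; ⊆-antisym; ∪-comm; x∈p∪q⁻; x∈p∪q⁺; x∈p∩q⁺)
open import Data.Product using (_×_; ∃; _,_)
open import Data.Sum using (_⊎_; inj₁; inj₂)
open import Data.Empty using (⊥-elim)
open import Relation.Binary.PropositionalEquality using (_≡_; refl; subst; sym)
open import Relation.Nullary using (¬_)

∪≡⊤⇒∈⊎∈ : ∀ {n} {C D : Subset n} → C ∪ D ≡ ⊤ → ∀ x → x ∈ C ⊎ x ∈ D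
∪≡⊤⇒∈⊎∈ {C = C} {D} C∪D≡⊤ x = x∈p∪q⁻ C D (subst (x ∈_) (sym C∪D≡⊤) ∈⊤)

⊂-cover⇒meets-and-covers : ∀ {n} {C D S : Subset n} → C ∪ D ≡ ⊤ → C ⊂ S
                         → Nonempty (S ∩ D) × S ∪ D ≡ ⊤
⊂-cover⇒meets-and-covers {C = C} {D} {S} C∪D≡⊤ (C⊆S , x , x∈S , x∉C) =
  meets , ⊆-antisym ⊆⊤ covers′
  where
  C⊎D : ∀ y → y ∈ C ⊎ y ∈ D
  C⊎D = ∪≡⊤⇒∈⊎∈ C∪D≡⊤

  meets : Nonempty (S ∩ D)
  meets with C⊎D x
  ... | inj₁ x∈C = ⊥-elim (x∉C x∈C)
  ... | inj₂ x∈D = x , x∈p∩q⁺ (x∈S , x∈D)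

  covers′ : ∀ {y} → y ∈ ⊤ → y ∈ S ∪ D
  covers′ {y} _ with C⊎D y
  ... | inj₁ y∈C = x∈p∪q⁺ (inj₁ (C⊆S y∈C))
  ... | inj₂ y∈D = x∈p∪q⁺ (inj₂ y∈D)

other-component : ∀ {n} (P : TwoPartition n) {C : Subset n} → IsComponent P C
                → ∃ λ D → IsComponent P D × C ∪ D ≡ ⊤
other-component P (inj₁ refl) = B P , inj₂ refl , covers P
other-component P (inj₂ refl) = A P , inj₁ refl , subst (_≡ ⊤) (∪-comm (A P) (B P)) (covers P)

lemma25 : ∀ {n L} (G : TemporalGraph n L)
    → (∀ (i j : Fin L) → toℕ j ≡ suc (toℕ i) → ¬ SamePartition (G i) (G j))
    → ∀ (i j : Fin L) → toℕ j ≡ suc (toℕ i)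
    → Restricted (G i) (G j)
    → ∀ (B : Subset n) → Shrinking (G i) (G j) B
    → ∃ λ (C : Subset n) → IsComponent (G j) C × Nonempty (B ∩ C) × B ∪ C ≡ ⊤
lemma25 G _ i j _ _ B (_ , C , C-component , C⊂B)
  with other-component (G j) C-component
... | D , D-component , C∪D≡⊤ = D , D-component , ⊂-cover⇒meets-and-covers C∪D≡⊤ C⊂B
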